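{- Let $a$ be a positive integer and let $(t,q)_a$ be a potentially helpful pair. Then $(t,q)_a$ is a helpful pair of the first kind if and only if it is a helpful pair of the second kind.
   Context: $S_k(m):=\sum_{j=1}^{m-1}j^k$ and $T_k(m):=\sum_{j=1}^{m}(2j-1)^k$ for positive integers $k,m$. Write Bernoulli numbers (defined by $\frac{z}{e^z-1}=\sum_{j\ge0}B_j\frac{z^j}{j!}$) as $B_j=U_j/V_j$ in lowest terms. An odd prime $p$ is irregular if $p\mid U_r$ for some even $r\le p-3$; such pairs $(r,p)$ are irregular pairs. For a positive integer $a$, a pair $(t,q)_a$ with $q>3$ prime and $t$ even, $2\le t\le q-3$, is a potentially helpful pair if $q\nmid a$ and, in case $q$ is irregular, $(t,q)$ is not an irregular pair. A potentially helpful pair $(t,q)_a$ is a helpful pair of the first kind if for every positive integer $x$, $aS_t(x)\equiv x^t\pmod q$ implies $x\equiv0\pmod q$; it is a helpful pair of the second kind if for every positive integer $x$, $aT_t(x)\equiv(2x+1)^t\pmod q$ implies $2x+1\equiv 0\pmod q$. -}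

module Defs where

open import Data.Nat as ℕ using (ℕ; zero; suc; _≤_; _<_)
open import Data.Nat.Combinatorics using (_C_)
open import Data.Nat.Primality using (Prime)
open import Data.Nat.Divisibility using (_∣_)
open import Data.Integer as ℤ using (ℤ; +_)
import Data.Integer.Divisibility as ℤD
open import Data.Rational as ℚ using (ℚ; 0ℚ; 1ℚ; _/_)
open import Data.List using (List; []; _∷_; reverse; upTo; zip; foldr; map)
open import Data.Product using (_×_; _,_)
open import Relation.Nullary using (¬_)

-- Bernoulli numbers via the standard recurrence equivalent to z/(e^z-1):
-- B_0 = 1, and for m ≥ 1:  Σ_{k=0}^{m} C(m+1,k) B_k = 0, i.e.
-- B_m = -(1/(m+1)) Σ_{k=0}^{m-1} C(m+1,k) B_k.

nextBernoulli : ℕ → List ℚ → ℚ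
nextBernoulli m bs =
  ℚ.- ((+ 1 / suc m) ℚ.* foldr ℚ._+_ 0ℚ
        (map (λ { (k , b) → ((+ (suc m C k)) / 1) ℚ.* b }) (zip (upTo m) bs)))

-- bernoulliRev n = [B_n, B_{n-1}, …, B_0]
bernoulliRev : ℕ → List ℚ
bernoulliRev zero = 1ℚ ∷ []
bernoulliRev (suc n) = nextBernoulli (suc n) (reverse (bernoulliRev n)) ∷ bernoulliRev n

bernoulli : ℕ → ℚ
bernoulli n with bernoulliRev n
... | [] = 0ℚ
... | b ∷ _ = b

-- U_j : numerator of B_j in lowest terms (stdlib ℚ is always normalised)
bernoulliNumerator : ℕ → ℤ
bernoulliNumerator j = ℚ.numerator (bernoulli j)

Even : ℕ → Set
Even n = 2 ∣ n

IrregularPair : ℕ → ℕ → Set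
IrregularPair r p =
  Prime p × ¬ (2 ∣ p) × Even r × 2 ≤ r × r ℕ.+ 3 ≤ p × (+ p) ℤD.∣ bernoulliNumerator r

infix 4 _≡_[mod_]
_≡_[mod_] : ℕ → ℕ → ℕ → Set
x ≡ y [mod m ] = (+ m) ℤD.∣ ((+ x) ℤ.- (+ y))

sumFrom1 : ℕ → (ℕ → ℕ) → ℕ
sumFrom1 zero f = 0
sumFrom1 (suc n) f = sumFrom1 n f ℕ.+ f (suc n)

S : ℕ → ℕ → ℕ
S k m = sumFrom1 (m ℕ.∸ 1) (λ j → j ℕ.^ k)

T : ℕ → ℕ → ℕ
T k m = sumFrom1 m (λ j → (2 ℕ.* j ℕ.∸ 1) ℕ.^ k)

PotentiallyHelpful : ℕ → ℕ → ℕ → Set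
PotentiallyHelpful a t q =
  Prime q × 3 < q × Even t × 2 ≤ t × t ℕ.+ 3 ≤ q × ¬ (q ∣ a) × ¬ IrregularPair t q

HelpfulFirstKind : ℕ → ℕ → ℕ → Set
HelpfulFirstKind a t q =
  PotentiallyHelpful a t q ×
  (∀ (x : ℕ) → 1 ≤ x → a ℕ.* S t x ≡ x ℕ.^ t [mod q ] → q ∣ x)

HelpfulSecondKind : ℕ → ℕ → ℕ → Set
HelpfulSecondKind a t q =
  PotentiallyHelpful a t q ×
  (∀ (x : ℕ) → 1 ≤ x → a ℕ.* T t x ≡ (2 ℕ.* x ℕ.+ 1) ℕ.^ t [mod q ] → q ∣ 2 ℕ.* x ℕ.+ 1)

module Submission where

-- Let q = 2c + 1 be a prime and t an even exponent with 0 < t < q - 1.  Write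
-- f j = j^t.  Everything rests on three congruences modulo q:
--   (1) the power sum f 1 + … + f (q-1) vanishes (Newton's recurrence
--       Σ_{i≤k} C(k+1,i)·(Σ_{j<n} j^i) = n^(k+1), from the binomial theorem,
--       and strong induction on the exponent);
--   (2) pairing j with q - j (their even powers agree), the half sum
--       f 1 + … + f c vanishes, so S_t is q-periodic and
--       T_t(x) ≡ 2^t·S_t(c + x + 1), because 2(c + j) = q + (2j - 1);
--   (3) modulo q one may cancel the factor 2^t.
-- With m = c + x + 1 we have 2m = q + (2x + 1), so a solution x of the
-- second-kind congruence gives the solution m of the first-kind one, and a
-- solution x of the first kind gives the solution x + c of the second kind;
-- divisibility by q corresponds in both directions.

open import Defs
open import Data.Nat.Base
  using (ℕ; zero; suc; _+_; _*_; _∸_; _^_; _≤_; _<_; z≤n; s≤s; NonZero)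
open import Data.Nat.Properties
open import Data.Nat.DivMod
  using (_%_; _/_; %-distribˡ-+; %-distribˡ-*; [m+kn]%n≡m%n; [m+n]%n≡m%n; m≡m%n+[m/n]*n)
open import Data.Nat.Divisibility
  using (_∣_; divides; ∣-refl; ∣-trans; 1∣_; _∣0; ∣m+n∣m⇒∣n; ∣m∣n⇒∣m+n; ∣n⇒∣m*n;
         m∣m*n; n∣m*n; ∣⇒≤; n∣m⇒m%n≡0)
open import Data.Nat.Combinatorics using (_C_; nCn≡1; nC1≡n; nCk≡nC[n∸k])
open import Data.Nat.Primality using (Prime; euclidsLemma; prime⇒irreducible)
open import Data.Nat.Induction using (<-rec)
open import Data.Nat.Tactic.RingSolver using (solve-∀)
open import Data.Fin.Base using (toℕ; fromℕ; inject₁)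
open import Data.Fin.Properties using (toℕ-fromℕ; toℕ-inject₁)
open import Data.Product using (∃-syntax; _,_; map₂)
open import Data.Sum using (_⊎_; inj₁; inj₂)
open import Data.Empty using (⊥-elim)
open import Function.Bundles using (_⇔_; mk⇔; Equivalence)
open import Level using (0ℓ)
open import Relation.Nullary using (¬_)
open import Relation.Binary.Bundles using (Setoid)
open import Relation.Binary.PropositionalEquality
  using (_≡_; refl; sym; trans; cong; cong₂; subst; module ≡-Reasoning)
import Relation.Binary.Reasoning.Setoid as SetoidReasoning
import Data.Integer as ℤ
import Data.Integer.Properties as ℤ
open import Algebra.Properties.CommutativeMonoid.Sum +-0-commutativeMonoid
  using (sum-syntax; ∑-comm; sum-init-last; sum-cong-≗)
open import Algebra.Properties.Semiring.Sum +-*-semiring using (*-distribˡ-sum)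
open import Algebra.Properties.Semiring.Exp +-*-semiring using () renaming (_^_ to _^ˢ_)
open import Algebra.Properties.Semiring.Mult +-*-semiring using () renaming (_×_ to _×ˢ_)
import Algebra.Properties.CommutativeSemiring.Binomial +-*-commutativeSemiring as Binomial
import Algebra.Properties.CommutativeSemiring.Exp +-*-commutativeSemiring as Exp
import Algebra.Properties.CommutativeSemigroup +-commutativeSemigroup as +-Comm
import Algebra.Properties.CommutativeSemigroup *-commutativeSemigroup as *-Comm

×ˢ≗* : ∀ n x → n ×ˢ x ≡ n * x
×ˢ≗* zero    x = refl
×ˢ≗* (suc n) x = cong (x +_) (×ˢ≗* n x)

^ˢ≗^ : ∀ x n → x ^ˢ n ≡ x ^ n
^ˢ≗^ x zero    = refl
^ˢ≗^ x (suc n) = cong (x *_) (^ˢ≗^ x n)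

^-distribʳ-* : ∀ x y n → (x * y) ^ n ≡ x ^ n * y ^ n
^-distribʳ-* x y n = begin
  (x * y) ^ n        ≡⟨ ^ˢ≗^ (x * y) n ⟨
  (x * y) ^ˢ n       ≡⟨ Exp.^-distrib-* x y n ⟩
  x ^ˢ n * y ^ˢ n    ≡⟨ cong₂ _*_ (^ˢ≗^ x n) (^ˢ≗^ y n) ⟩
  x ^ n * y ^ n      ∎
  where open ≡-Reasoning

0^-positive : ∀ {k} → 0 < k → 0 ^ k ≡ 0
0^-positive {suc k} _ = refl

^-even : ∀ v s → v ^ (2 * s) ≡ (v * v) ^ s
^-even v s = begin
  v ^ (2 * s)    ≡⟨ ^-*-assoc v 2 s ⟨
  (v ^ 2) ^ s    ≡⟨ cong (λ w → (v * w) ^ s) (*-identityʳ v) ⟩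
  (v * v) ^ s    ∎
  where open ≡-Reasoning

sumBelow : ℕ → (ℕ → ℕ) → ℕ
sumBelow n f = ∑[ i < n ] f (toℕ i)

sumBelow-cong : ∀ n {f g : ℕ → ℕ} → (∀ i → f i ≡ g i) → sumBelow n f ≡ sumBelow n g
sumBelow-cong n {f} {g} f≗g =
  sum-cong-≗ {n} {λ i → f (toℕ i)} {λ i → g (toℕ i)} (λ i → f≗g (toℕ i))

sumBelow-last : ∀ n (f : ℕ → ℕ) → sumBelow (suc n) f ≡ sumBelow n f + f n
sumBelow-last n f = begin
  sumBelow (suc n) f                                ≡⟨ sum-init-last (λ i → f (toℕ i)) ⟩
  ∑[ i < n ] f (toℕ (inject₁ i)) + f (toℕ (fromℕ n))
    ≡⟨ cong₂ _+_ (sum-cong-≗ {n} {λ i → f (toℕ (inject₁ i))} {λ i → f (toℕ i)} (λ i → cong f (toℕ-inject₁ i)))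
                 (cong f (toℕ-fromℕ n)) ⟩
  sumBelow n f + f n                                ∎
  where open ≡-Reasoning

sumBelow-∣ : ∀ {d} n (f : ℕ → ℕ) → (∀ i → i < n → d ∣ f i) → d ∣ sumBelow n f
sumBelow-∣ {d} zero    f d∣f = d ∣0
sumBelow-∣     (suc n) f d∣f =
  ∣m∣n⇒∣m+n (d∣f 0 (s≤s z≤n)) (sumBelow-∣ n (λ i → f (suc i)) (λ i i<n → d∣f (suc i) (s≤s i<n)))

telescope : ∀ (g D : ℕ → ℕ) → (∀ j → D j + g j ≡ g (suc j)) → ∀ n → sumBelow n D + g 0 ≡ g n
telescope g D step zero    = refl
telescope g D step (suc n) = begin
  sumBelow (suc n) D + g 0    ≡⟨ cong (_+ g 0) (sumBelow-last n D) ⟩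
  sumBelow n D + D n + g 0    ≡⟨ +-Comm.xy∙z≈y∙xz (sumBelow n D) (D n) (g 0) ⟩
  D n + (sumBelow n D + g 0)  ≡⟨ cong (D n +_) (telescope g D step n) ⟩
  D n + g n                   ≡⟨ step n ⟩
  g (suc n)                   ∎
  where open ≡-Reasoning

binomial-succ : ∀ k j → sumBelow (suc k) (λ i → (suc k C i) * j ^ i) + j ^ suc k ≡ suc j ^ suc k
binomial-succ k j = begin
  sumBelow (suc k) term + j ^ suc k        ≡⟨ cong (sumBelow (suc k) term +_) top ⟨
  sumBelow (suc k) term + term (suc k)     ≡⟨ sumBelow-last (suc k) term ⟨
  sumBelow (suc (suc k)) term              ≡⟨ sumBelow-cong (suc (suc k)) expansion-term ⟨
  Binomial.binomialExpansion j 1 (suc k)   ≡⟨ Binomial.theorem (suc k) j 1 ⟨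
  (j + 1) ^ˢ suc k                         ≡⟨ ^ˢ≗^ (j + 1) (suc k) ⟩
  (j + 1) ^ suc k                          ≡⟨ cong (_^ suc k) (+-comm j 1) ⟩
  suc j ^ suc k                            ∎
  where
  open ≡-Reasoning
  term : ℕ → ℕ
  term i = (suc k C i) * j ^ i
  top : term (suc k) ≡ j ^ suc k
  top = trans (cong (_* j ^ suc k) (nCn≡1 (suc k))) (*-identityˡ (j ^ suc k))
  expansion-term : ∀ i → (suc k C i) ×ˢ (j ^ˢ i * 1 ^ˢ (suc k ∸ i)) ≡ term i
  expansion-term i = begin
    (suc k C i) ×ˢ (j ^ˢ i * 1 ^ˢ (suc k ∸ i))  ≡⟨ ×ˢ≗* (suc k C i) _ ⟩
    (suc k C i) * (j ^ˢ i * 1 ^ˢ (suc k ∸ i))   ≡⟨ cong₂ (λ u v → (suc k C i) * (u * v))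
                                                     (^ˢ≗^ j i) (trans (^ˢ≗^ 1 (suc k ∸ i)) (^-zeroˡ (suc k ∸ i))) ⟩
    (suc k C i) * (j ^ i * 1)                   ≡⟨ cong ((suc k C i) *_) (*-identityʳ (j ^ i)) ⟩
    term i                                      ∎

powerSum : ℕ → ℕ → ℕ
powerSum k n = sumBelow n (λ j → j ^ k)

-- Newton's recurrence: Σ_{i≤k} C(k+1,i)·powerSum i n = n^(k+1).  Swap the two
-- sums and telescope the binomial expansions of (j + 1)^(k+1) - j^(k+1).
powerSum-recurrence : ∀ k n → sumBelow (suc k) (λ i → (suc k C i) * powerSum i n) ≡ n ^ suc k
powerSum-recurrence k n = begin
  sumBelow (suc k) (λ i → (suc k C i) * powerSum i n)
    ≡⟨ sumBelow-cong (suc k) (λ i → *-distribˡ-sum {n} (suc k C i) (λ j → toℕ j ^ i)) ⟩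
  (∑[ i < suc k ] ∑[ j < n ] ((suc k C toℕ i) * toℕ j ^ toℕ i))
    ≡⟨ ∑-comm {suc k} {n} (λ i j → (suc k C toℕ i) * toℕ j ^ toℕ i) ⟩
  sumBelow n (λ j → sumBelow (suc k) (λ i → (suc k C i) * j ^ i))
    ≡⟨ +-identityʳ _ ⟨
  sumBelow n (λ j → sumBelow (suc k) (λ i → (suc k C i) * j ^ i)) + 0 ^ suc k
    ≡⟨ telescope (_^ suc k) _ (binomial-succ k) n ⟩
  n ^ suc k
    ∎
  where open ≡-Reasoning

prime-∣-*ʳ : ∀ {p m k} → Prime p → ¬ p ∣ m → p ∣ m * k → p ∣ k
prime-∣-*ʳ {m = m} {k} p-prime p∤m p∣mk with euclidsLemma m k p-prime p∣mk
... | inj₁ p∣m = ⊥-elim (p∤m p∣m)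
... | inj₂ p∣k = p∣k

-- By strong
-- induction on k: in Newton's recurrence for n = p all lower terms and p^(k+1)
-- are divisible by p, leaving (k + 1)·powerSum k p, and p ∤ k + 1.
powerSum-vanishes : ∀ {p} → Prime p → ∀ k → suc k < p → p ∣ powerSum k p
powerSum-vanishes {p} p-prime = <-rec (λ k → suc k < p → p ∣ powerSum k p) step
  where
  step : ∀ k → (∀ {i} → i < k → suc i < p → p ∣ powerSum i p) → suc k < p → p ∣ powerSum k p
  step k ih k+1<p = prime-∣-*ʳ p-prime p∤k+1 p∣[k+1]*Sₖ
    where
    p∤k+1 : ¬ p ∣ suc k
    p∤k+1 p∣k+1 = <⇒≱ k+1<p (∣⇒≤ p∣k+1)
    k+1Ck≡k+1 : suc k C k ≡ suc k
    k+1Ck≡k+1 = trans (nCk≡nC[n∸k] (n≤1+n k)) (trans (cong (suc k C_) (m+n∸n≡m 1 k)) (nC1≡n (suc k)))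
    term : ℕ → ℕ
    term i = (suc k C i) * powerSum i p
    recurrence : sumBelow k term + suc k * powerSum k p ≡ p ^ suc k
    recurrence = begin
      sumBelow k term + suc k * powerSum k p  ≡⟨ cong (λ b → sumBelow k term + b * powerSum k p) k+1Ck≡k+1 ⟨
      sumBelow k term + term k                ≡⟨ sumBelow-last k term ⟨
      sumBelow (suc k) term                   ≡⟨ powerSum-recurrence k p ⟩
      p ^ suc k                               ∎
      where open ≡-Reasoning
    p∣[k+1]*Sₖ : p ∣ suc k * powerSum k p
    p∣[k+1]*Sₖ = ∣m+n∣m⇒∣n (subst (p ∣_) (sym recurrence) (m∣m*n (p ^ k)))
      (sumBelow-∣ k term (λ i i<k → ∣n⇒∣m*n (suc k C i) (ih i<k (<-trans (s≤s i<k) k+1<p))))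

sumBelow-sumFrom1 : ∀ n (f : ℕ → ℕ) → sumBelow (suc n) f ≡ f 0 + sumFrom1 n f
sumBelow-sumFrom1 zero    f = refl
sumBelow-sumFrom1 (suc n) f = begin
  sumBelow (suc (suc n)) f        ≡⟨ sumBelow-last (suc n) f ⟩
  sumBelow (suc n) f + f (suc n)  ≡⟨ cong (_+ f (suc n)) (sumBelow-sumFrom1 n f) ⟩
  f 0 + sumFrom1 n f + f (suc n)  ≡⟨ +-assoc (f 0) _ _ ⟩
  f 0 + sumFrom1 (suc n) f        ∎
  where open ≡-Reasoning

sumFrom1-first : ∀ m (f : ℕ → ℕ) → sumFrom1 (suc m) f ≡ f 1 + sumFrom1 m (λ i → f (suc i))
sumFrom1-first zero    f = +-comm 0 (f 1)
sumFrom1-first (suc m) f = begin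
  sumFrom1 (suc m) f + f (suc (suc m))                    ≡⟨ cong (_+ f (suc (suc m))) (sumFrom1-first m f) ⟩
  f 1 + sumFrom1 m (λ i → f (suc i)) + f (suc (suc m))    ≡⟨ +-assoc (f 1) _ _ ⟩
  f 1 + sumFrom1 (suc m) (λ i → f (suc i))                ∎
  where open ≡-Reasoning

sumFrom1-split : ∀ n m (f : ℕ → ℕ) → sumFrom1 (n + m) f ≡ sumFrom1 n f + sumFrom1 m (λ i → f (n + i))
sumFrom1-split n zero    f = trans (cong (λ k → sumFrom1 k f) (+-identityʳ n)) (sym (+-identityʳ _))
sumFrom1-split n (suc m) f = begin
  sumFrom1 (n + suc m) f                                        ≡⟨ cong (λ k → sumFrom1 k f) (+-suc n m) ⟩
  sumFrom1 (n + m) f + f (suc (n + m))                          ≡⟨ cong₂ _+_ (sumFrom1-split n m f) (cong f (sym (+-suc n m))) ⟩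
  sumFrom1 n f + sumFrom1 m (λ i → f (n + i)) + f (n + suc m)   ≡⟨ +-assoc (sumFrom1 n f) _ _ ⟩
  sumFrom1 n f + sumFrom1 (suc m) (λ i → f (n + i))             ∎
  where open ≡-Reasoning

sumFrom1-reverse : ∀ m (f : ℕ → ℕ) → sumFrom1 m f ≡ sumFrom1 m (λ i → f (suc m ∸ i))
sumFrom1-reverse zero    f = refl
sumFrom1-reverse (suc m) f = begin
  sumFrom1 m f + f (suc m)                          ≡⟨ +-comm _ (f (suc m)) ⟩
  f (suc m) + sumFrom1 m f                          ≡⟨ cong (f (suc m) +_) (sumFrom1-reverse m f) ⟩
  f (suc m) + sumFrom1 m (λ i → f (suc m ∸ i))      ≡⟨ sumFrom1-first m (λ i → f (suc (suc m) ∸ i)) ⟨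
  sumFrom1 (suc m) (λ i → f (suc (suc m) ∸ i))      ∎
  where open ≡-Reasoning

∣+x-+y∣≡x∸y : ∀ {x y} → y ≤ x → ℤ.∣ ℤ.+ x ℤ.- ℤ.+ y ∣ ≡ x ∸ y
∣+x-+y∣≡x∸y {x} {y} y≤x = begin
  ℤ.∣ ℤ.+ x ℤ.- ℤ.+ y ∣  ≡⟨ ℤ.∣i-j∣≡∣j-i∣ (ℤ.+ x) (ℤ.+ y) ⟩
  ℤ.∣ ℤ.+ y ℤ.- ℤ.+ x ∣  ≡⟨ cong ℤ.∣_∣ (ℤ.[+m]-[+n]≡m⊖n y x) ⟩
  ℤ.∣ y ℤ.⊖ x ∣          ≡⟨ ℤ.∣⊖∣-≤ y≤x ⟩
  x ∸ y                  ∎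
  where open ≡-Reasoning

module Congruence (n : ℕ) .{{_ : NonZero n}} where

  infix 4 _≈_
  record _≈_ (x y : ℕ) : Set where
    constructor mk≈
    field remainders : x % n ≡ y % n

  ≈-refl : ∀ {x} → x ≈ x
  ≈-refl = mk≈ refl

  ≈-sym : ∀ {x y} → x ≈ y → y ≈ x
  ≈-sym (mk≈ e) = mk≈ (sym e)

  ≈-trans : ∀ {x y z} → x ≈ y → y ≈ z → x ≈ z
  ≈-trans (mk≈ e) (mk≈ e′) = mk≈ (trans e e′)

  ≡⇒≈ : ∀ {x y} → x ≡ y → x ≈ y
  ≡⇒≈ refl = ≈-refl

  ≈-setoid : Setoid 0ℓ 0ℓ
  ≈-setoid = record
    { Carrier = ℕ ; _≈_ = _≈_
    ; isEquivalence = record { refl = ≈-refl ; sym = ≈-sym ; trans = ≈-trans } }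

  module ≈-Reasoning = SetoidReasoning ≈-setoid

  +-cong : ∀ {a b c d} → a ≈ b → c ≈ d → a + c ≈ b + d
  +-cong {a} {b} {c} {d} (mk≈ a≈b) (mk≈ c≈d) = mk≈ (begin
    (a + c) % n          ≡⟨ %-distribˡ-+ a c n ⟩
    (a % n + c % n) % n  ≡⟨ cong₂ (λ u v → (u + v) % n) a≈b c≈d ⟩
    (b % n + d % n) % n  ≡⟨ %-distribˡ-+ b d n ⟨
    (b + d) % n          ∎)
    where open ≡-Reasoning

  *-cong : ∀ {a b c d} → a ≈ b → c ≈ d → a * c ≈ b * d
  *-cong {a} {b} {c} {d} (mk≈ a≈b) (mk≈ c≈d) = mk≈ (begin
    (a * c) % n            ≡⟨ %-distribˡ-* a c n ⟩
    (a % n * (c % n)) % n  ≡⟨ cong₂ (λ u v → (u * v) % n) a≈b c≈d ⟩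
    (b % n * (d % n)) % n  ≡⟨ %-distribˡ-* b d n ⟨
    (b * d) % n            ∎)
    where open ≡-Reasoning

  *-congˡ : ∀ k {a b} → a ≈ b → k * a ≈ k * b
  *-congˡ k = *-cong (≈-refl {k})

  ^-congˡ : ∀ {a b} → a ≈ b → ∀ k → a ^ k ≈ b ^ k
  ^-congˡ a≈b zero    = ≈-refl
  ^-congˡ a≈b (suc k) = *-cong a≈b (^-congˡ a≈b k)

  +-absorbʳ : ∀ x → x + n ≈ x
  +-absorbʳ x = mk≈ ([m+n]%n≡m%n x n)

  +-absorbˡ : ∀ x → n + x ≈ x
  +-absorbˡ x = ≈-trans (≡⇒≈ (+-comm n x)) (+-absorbʳ x)

  ∣⇒≈0 : ∀ {x} → n ∣ x → x ≈ 0
  ∣⇒≈0 {x} n∣x = mk≈ (trans (n∣m⇒m%n≡0 x n n∣x) (sym (n∣m⇒m%n≡0 0 n (n ∣0))))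

  ≈⇔∣∸ : ∀ {x y} → y ≤ x → x ≈ y ⇔ n ∣ x ∸ y
  ≈⇔∣∸ {x} {y} y≤x = mk⇔ to from
    where
    to : x ≈ y → n ∣ x ∸ y
    to (mk≈ e) = divides (x / n ∸ y / n) (begin
      x ∸ y                                      ≡⟨ cong₂ _∸_ (m≡m%n+[m/n]*n x n) (m≡m%n+[m/n]*n y n) ⟩
      (x % n + x / n * n) ∸ (y % n + y / n * n)  ≡⟨ cong (λ r → (r + x / n * n) ∸ (y % n + y / n * n)) e ⟩
      (y % n + x / n * n) ∸ (y % n + y / n * n)  ≡⟨ [m+n]∸[m+o]≡n∸o (y % n) _ _ ⟩
      x / n * n ∸ y / n * n                      ≡⟨ *-distribʳ-∸ n (x / n) (y / n) ⟨
      (x / n ∸ y / n) * n                        ∎)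
      where open ≡-Reasoning
    from : n ∣ x ∸ y → x ≈ y
    from (divides k x∸y≡kn) = mk≈ (begin
      x % n                ≡⟨ cong (_% n) (m+[n∸m]≡n y≤x) ⟨
      (y + (x ∸ y)) % n    ≡⟨ cong (λ d → (y + d) % n) x∸y≡kn ⟩
      (y + k * n) % n      ≡⟨ [m+kn]%n≡m%n y k n ⟩
      y % n                ∎)
      where open ≡-Reasoning

  ≈-wlog : ∀ {R : ℕ → ℕ → Set} → (∀ {a b} → R a b → R b a) →
           (∀ {a b} → b ≤ a → R a b → a ≈ b) → ∀ {a b} → R a b → a ≈ b
  ≈-wlog R-sym ordered {a} {b} r with ≤-total b a
  ... | inj₁ b≤a = ordered b≤a r
  ... | inj₂ a≤b = ≈-sym (ordered a≤b (R-sym r))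

  +-cancelˡ : ∀ c {a b} → c + a ≈ c + b → a ≈ b
  +-cancelˡ c = ≈-wlog ≈-sym λ {a} {b} b≤a c+a≈c+b →
    Equivalence.from (≈⇔∣∸ b≤a)
      (subst (n ∣_) ([m+n]∸[m+o]≡n∸o c a b) (Equivalence.to (≈⇔∣∸ (+-monoʳ-≤ c b≤a)) c+a≈c+b))

  *-cancelˡ : Prime n → ∀ k {a b} → ¬ n ∣ k → k * a ≈ k * b → a ≈ b
  *-cancelˡ n-prime k n∤k = ≈-wlog ≈-sym λ {a} {b} b≤a ka≈kb →
    Equivalence.from (≈⇔∣∸ b≤a)
      (prime-∣-*ʳ n-prime n∤k
        (subst (n ∣_) (sym (*-distribˡ-∸ k a b)) (Equivalence.to (≈⇔∣∸ (*-monoʳ-≤ k b≤a)) ka≈kb)))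

  ≈⇔mod : ∀ {x y} → x ≈ y ⇔ (x ≡ y [mod n ])
  ≈⇔mod {x} {y} with ≤-total y x
  ... | inj₁ y≤x = mk⇔
    (λ x≈y → subst (n ∣_) (sym (∣+x-+y∣≡x∸y y≤x)) (Equivalence.to (≈⇔∣∸ y≤x) x≈y))
    (λ x≡y → Equivalence.from (≈⇔∣∸ y≤x) (subst (n ∣_) (∣+x-+y∣≡x∸y y≤x) x≡y))
  ... | inj₂ x≤y = mk⇔
    (λ x≈y → subst (n ∣_) (sym dist) (Equivalence.to (≈⇔∣∸ x≤y) (≈-sym x≈y)))
    (λ x≡y → ≈-sym (Equivalence.from (≈⇔∣∸ x≤y) (subst (n ∣_) dist x≡y)))
    where
    dist : ℤ.∣ ℤ.+ x ℤ.- ℤ.+ y ∣ ≡ y ∸ x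
    dist = trans (ℤ.∣i-j∣≡∣j-i∣ (ℤ.+ x) (ℤ.+ y)) (∣+x-+y∣≡x∸y x≤y)

  -- If u + i ≡ n then u ≡ -i, so u and i have congruent even powers.
  even-power-symmetric : ∀ {u i} → u + i ≡ n → ∀ {t} → 2 ∣ t → u ^ t ≈ i ^ t
  even-power-symmetric {u} {i} u+i≡n {t} (divides s t≡s*2) = begin
    u ^ t          ≡⟨ cong (u ^_) t≡2s ⟩
    u ^ (2 * s)    ≡⟨ ^-even u s ⟩
    (u * u) ^ s    ≈⟨ ^-congˡ squares s ⟩
    (i * i) ^ s    ≡⟨ ^-even i s ⟨
    i ^ (2 * s)    ≡⟨ cong (i ^_) t≡2s ⟨
    i ^ t          ∎
    where
    open ≈-Reasoning
    t≡2s : t ≡ 2 * s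
    t≡2s = trans t≡s*2 (*-comm s 2)
    squares : u * u ≈ i * i
    squares = +-cancelˡ (u * i) (begin
      u * i + u * u  ≡⟨ *-distribˡ-+ u i u ⟨
      u * (i + u)    ≡⟨ cong (u *_) (trans (+-comm i u) u+i≡n) ⟩
      u * n          ≈⟨ ∣⇒≈0 (n∣m*n u) ⟩
      0              ≈⟨ ∣⇒≈0 (m∣m*n i) ⟨
      n * i          ≡⟨ cong (_* i) u+i≡n ⟨
      (u + i) * i    ≡⟨ *-distribʳ-+ i u i ⟩
      u * i + i * i  ∎)

  sumFrom1-cong≈ : ∀ m {g h : ℕ → ℕ} → (∀ i → i ≤ m → g i ≈ h i) → sumFrom1 m g ≈ sumFrom1 m h
  sumFrom1-cong≈ zero    g≈h = ≈-refl
  sumFrom1-cong≈ (suc m) g≈h =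
    +-cong (sumFrom1-cong≈ m (λ i i≤m → g≈h i (m≤n⇒m≤1+n i≤m))) (g≈h (suc m) ≤-refl)

  sumFrom1-periodic : ∀ p (g : ℕ → ℕ) → (∀ i → g (i + p) ≈ g i) → sumFrom1 p g ≈ 0 →
                      ∀ m → sumFrom1 (m + p) g ≈ sumFrom1 m g
  sumFrom1-periodic p g periodic period-sum zero    = period-sum
  sumFrom1-periodic p g periodic period-sum (suc m) =
    +-cong (sumFrom1-periodic p g periodic period-sum m) (periodic (suc m))

-- Arithmetic of the correspondence x ↦ c + x + 1 between the two problems.
odd-successor : ∀ x → 2 * suc x ∸ 1 ≡ 2 * x + 1
odd-successor x = trans (+-suc x (x + 0)) (+-comm 1 (2 * x))

twice-shifted : ∀ c x → 2 * suc (c + x) ≡ suc (c + c) + (2 * x + 1)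
twice-shifted = solve-∀

shifted-twice : ∀ c x → 2 * (x + c) + 1 ≡ suc (c + c) + 2 * x
shifted-twice = solve-∀

shift-by-period : ∀ c x → suc (c + (x + c)) ≡ x + suc (c + c)
shift-by-period = solve-∀

module OddPrime (c t : ℕ) (q-prime : Prime (suc (c + c))) (t-even : Even t)
                (0<t : 0 < t) (t+1<q : suc t < suc (c + c)) where

  q : ℕ
  q = suc (c + c)

  open Congruence q

  q∤2 : ¬ q ∣ 2
  q∤2 q∣2 = <⇒≱ (≤-<-trans (s≤s 0<t) t+1<q) (∣⇒≤ q∣2)

  q∤2^ : ∀ k → ¬ q ∣ 2 ^ k
  q∤2^ zero    q∣1   = q∤2 (∣-trans q∣1 (1∣ 2))
  q∤2^ (suc k) q∣2^k+1 = q∤2^ k (prime-∣-*ʳ q-prime q∤2 q∣2^k+1)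

  full-sum : sumFrom1 (c + c) (_^ t) ≈ 0
  full-sum = ∣⇒≈0 (subst (q ∣_) powerSum≡ (powerSum-vanishes q-prime t t+1<q))
    where
    powerSum≡ : powerSum t q ≡ sumFrom1 (c + c) (_^ t)
    powerSum≡ = trans (sumBelow-sumFrom1 (c + c) (_^ t)) (cong (_+ sumFrom1 (c + c) (_^ t)) (0^-positive 0<t))

  mirror : ∀ i → i ≤ suc c → c + (suc c ∸ i) + i ≡ q
  mirror i i≤c+1 = begin
    c + (suc c ∸ i) + i    ≡⟨ +-assoc c _ i ⟩
    c + (suc c ∸ i + i)    ≡⟨ cong (c +_) (m∸n+n≡m i≤c+1) ⟩
    c + suc c              ≡⟨ +-suc c c ⟩
    q                      ∎
    where open ≡-Reasoning

  -- (2) 1^t + … + c^t ≡ 0: the upper half (c+1)^t + … + (2c)^t is congruent to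
  -- the lower half term by term, since (c + (c + 1 - i)) + i = q; and q ∤ 2.
  half-sum : sumFrom1 c (_^ t) ≈ 0
  half-sum = *-cancelˡ q-prime 2 q∤2 (begin
    2 * X                                             ≡⟨ cong (X +_) (+-identityʳ X) ⟩
    X + X                                             ≈⟨ +-cong (≈-refl {X}) mirrored ⟨
    X + sumFrom1 c (λ i → (c + (suc c ∸ i)) ^ t)      ≡⟨ cong (X +_) (sumFrom1-reverse c (λ i → (c + i) ^ t)) ⟨
    X + sumFrom1 c (λ i → (c + i) ^ t)                ≡⟨ sumFrom1-split c c (_^ t) ⟨
    sumFrom1 (c + c) (_^ t)                           ≈⟨ full-sum ⟩
    0                                                 ∎)
    where
    open ≈-Reasoning
    X : ℕ
    X = sumFrom1 c (_^ t)
    mirrored : sumFrom1 c (λ i → (c + (suc c ∸ i)) ^ t) ≈ X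
    mirrored = sumFrom1-cong≈ c (λ i i≤c → even-power-symmetric (mirror i (m≤n⇒m≤1+n i≤c)) t-even)

  -- S_t is periodic with period q: the terms repeat and a full period sums to 0.
  S-periodic : ∀ m → S t (m + q) ≈ S t m
  S-periodic zero    = full-sum
  S-periodic (suc m) = sumFrom1-periodic q (_^ t) (λ i → ^-congˡ (+-absorbʳ i) t) period-sum m
    where
    period-sum : sumFrom1 q (_^ t) ≈ 0
    period-sum = +-cong full-sum (∣⇒≈0 (subst (q ∣_) (cong (q ^_) (m+[n∸m]≡n 0<t)) (m∣m*n (q ^ (t ∸ 1)))))

  -- The odd numbers are doubled integers modulo q: 2(c + j) = q + (2j - 1), so
  -- T_t(x) ≡ 2^t·((c+1)^t + … + (c+x)^t) ≡ 2^t·S_t(c + x + 1) by the half sum.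
  T≈2^tS : ∀ x → T t x ≈ 2 ^ t * S t (suc (c + x))
  T≈2^tS zero = begin
    0                          ≡⟨ *-zeroʳ (2 ^ t) ⟨
    2 ^ t * 0                  ≈⟨ *-congˡ (2 ^ t) half-sum ⟨
    2 ^ t * sumFrom1 c (_^ t)  ≡⟨ cong (λ k → 2 ^ t * sumFrom1 k (_^ t)) (+-identityʳ c) ⟨
    2 ^ t * S t (suc (c + 0))  ∎
    where open ≈-Reasoning
  T≈2^tS (suc x) = begin
    T t x + (2 * suc x ∸ 1) ^ t                    ≈⟨ +-cong (T≈2^tS x) (≈-sym (^-congˡ (+-absorbˡ (2 * suc x ∸ 1)) t)) ⟩
    2 ^ t * S t m + (q + (2 * suc x ∸ 1)) ^ t      ≡⟨ cong (λ v → 2 ^ t * S t m + v ^ t) q+odd≡2m ⟩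
    2 ^ t * S t m + (2 * m) ^ t                    ≡⟨ cong (2 ^ t * S t m +_) (^-distribʳ-* 2 m t) ⟩
    2 ^ t * S t m + 2 ^ t * m ^ t                  ≡⟨ *-distribˡ-+ (2 ^ t) _ _ ⟨
    2 ^ t * (S t m + m ^ t)                        ≡⟨ cong (λ k → 2 ^ t * sumFrom1 k (_^ t)) (+-suc c x) ⟨
    2 ^ t * S t (suc (c + suc x))                  ∎
    where
    open ≈-Reasoning
    m : ℕ
    m = suc (c + x)
    q+odd≡2m : q + (2 * suc x ∸ 1) ≡ 2 * m
    q+odd≡2m = trans (cong (q +_) (odd-successor x)) (sym (twice-shifted c x))

  -- If x solves a·T_t(x) ≡ (2x+1)^t, then m = c + x + 1 solves a·S_t(m) ≡ m^t
  -- (multiply by 2^t and cancel it); q ∣ m gives q ∣ 2m = q + (2x + 1).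
  first⇒second : ∀ a → (∀ x → 1 ≤ x → a * S t x ≡ x ^ t [mod q ] → q ∣ x) →
                 ∀ x → 1 ≤ x → a * T t x ≡ (2 * x + 1) ^ t [mod q ] → q ∣ 2 * x + 1
  first⇒second a first x _ aT≡ = ∣m+n∣m⇒∣n (subst (q ∣_) (twice-shifted c x) (∣n⇒∣m*n 2 q∣m)) ∣-refl
    where
    m : ℕ
    m = suc (c + x)
    2^t·aS≈2^t·m^t : 2 ^ t * (a * S t m) ≈ 2 ^ t * m ^ t
    2^t·aS≈2^t·m^t = begin
      2 ^ t * (a * S t m)     ≡⟨ *-Comm.x∙yz≈y∙xz (2 ^ t) a (S t m) ⟩
      a * (2 ^ t * S t m)     ≈⟨ *-congˡ a (T≈2^tS x) ⟨
      a * T t x               ≈⟨ Equivalence.from ≈⇔mod aT≡ ⟩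
      (2 * x + 1) ^ t         ≈⟨ ^-congˡ (+-absorbˡ (2 * x + 1)) t ⟨
      (q + (2 * x + 1)) ^ t   ≡⟨ cong (_^ t) (twice-shifted c x) ⟨
      (2 * m) ^ t             ≡⟨ ^-distribʳ-* 2 m t ⟩
      2 ^ t * m ^ t           ∎
      where open ≈-Reasoning
    q∣m : q ∣ m
    q∣m = first m (s≤s z≤n) (Equivalence.to ≈⇔mod (*-cancelˡ q-prime (2 ^ t) (q∤2^ t) 2^t·aS≈2^t·m^t))

  -- If x solves a·S_t(x) ≡ x^t, then y = x + c solves a·T_t(y) ≡ (2y+1)^t,
  -- using the periodicity of S_t; q ∣ 2y + 1 = q + 2x gives q ∣ x.
  second⇒first : ∀ a → (∀ x → 1 ≤ x → a * T t x ≡ (2 * x + 1) ^ t [mod q ] → q ∣ 2 * x + 1) →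
                 ∀ x → 1 ≤ x → a * S t x ≡ x ^ t [mod q ] → q ∣ x
  second⇒first a second x 1≤x aS≡ = prime-∣-*ʳ q-prime q∤2 q∣2x
    where
    y : ℕ
    y = x + c
    aT≈[2y+1]^t : a * T t y ≈ (2 * y + 1) ^ t
    aT≈[2y+1]^t = begin
      a * T t y                      ≈⟨ *-congˡ a (T≈2^tS y) ⟩
      a * (2 ^ t * S t (suc (c + y))) ≡⟨ cong (λ k → a * (2 ^ t * S t k)) (shift-by-period c x) ⟩
      a * (2 ^ t * S t (x + q))       ≈⟨ *-congˡ a (*-congˡ (2 ^ t) (S-periodic x)) ⟩
      a * (2 ^ t * S t x)             ≡⟨ *-Comm.x∙yz≈y∙xz a (2 ^ t) (S t x) ⟩
      2 ^ t * (a * S t x)             ≈⟨ *-congˡ (2 ^ t) (Equivalence.from ≈⇔mod aS≡) ⟩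
      2 ^ t * x ^ t                   ≡⟨ ^-distribʳ-* 2 x t ⟨
      (2 * x) ^ t                     ≈⟨ ^-congˡ (+-absorbˡ (2 * x)) t ⟨
      (q + 2 * x) ^ t                 ≡⟨ cong (_^ t) (shifted-twice c x) ⟨
      (2 * y + 1) ^ t                 ∎
      where open ≈-Reasoning
    q∣2x : q ∣ 2 * x
    q∣2x = ∣m+n∣m⇒∣n (subst (q ∣_) (shifted-twice c x) (second y y≥1 (Equivalence.to ≈⇔mod aT≈[2y+1]^t))) ∣-refl
      where
      y≥1 : 1 ≤ y
      y≥1 = ≤-trans 1≤x (m≤m+n x c)

even-or-odd : ∀ n → ∃[ c ] (n ≡ c + c ⊎ n ≡ suc (c + c))
even-or-odd zero    = 0 , inj₁ refl
even-or-odd (suc n) with even-or-odd n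
... | c , inj₁ n≡c+c   = c , inj₂ (cong suc n≡c+c)
... | c , inj₂ n≡1+c+c = suc c , inj₁ (trans (cong suc n≡1+c+c) (sym (+-suc (suc c) c)))

double : ∀ c → c + c ≡ c * 2
double = solve-∀

odd-prime : ∀ {p} → Prime p → 2 < p → ∃[ c ] p ≡ suc (c + c)
odd-prime {p} p-prime 2<p with even-or-odd p
... | c , inj₂ p≡1+c+c = c , p≡1+c+c
... | c , inj₁ p≡c+c with prime⇒irreducible p-prime (divides c (trans p≡c+c (double c)))
...   | inj₁ ()
...   | inj₂ 2≡p = ⊥-elim (<-irrefl 2≡p 2<p)

lemma8 : (a t q : ℕ) → 1 ≤ a → PotentiallyHelpful a t q →
    (HelpfulFirstKind a t q ⇔ HelpfulSecondKind a t q)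
lemma8 a t q _ (q-prime , 3<q , t-even , 2≤t , t+3≤q , _ , _)
  with odd-prime q-prime (<-trans (n<1+n 2) 3<q)
... | c , refl = mk⇔ (map₂ (first⇒second a)) (map₂ (second⇒first a))
  where
  t+1<q : suc t < q
  t+1<q = ≤-trans (n≤1+n (suc (suc t))) (subst (_≤ q) (+-comm t 3) t+3≤q)
  open OddPrime c t q-prime t-even (≤-trans (s≤s z≤n) 2≤t) t+1<q
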